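{- Let $s\ge 2$ and let $(G,W,k)$ be an instance of Seeded $s$-Club in which $W$ is a clique in $G$ and $|W|<k$. If $|N_{s-1}[W]|\ge k^2$, then $(G,W,k)$ is a yes-instance.
   Context: Seeded $s$-Club: given an undirected graph $G=(V,E)$, a set $W\subseteq V$ and an integer $k\ge 1$, decide whether $G$ contains a vertex set $S$ with $W\subseteq S$, $|S|\ge k$, and $G[S]$ of diameter at most $s$. For $W\subseteq V$ and $i\ge 0$, $N_i[W]$ denotes the set of vertices $u$ with $\min_{w\in W}\mathrm{dist}_G(u,w)\le i$. -}

module Defs where

open import Data.Nat using (ℕ; zero; suc; _≤_)
open import Data.Fin using (Fin)
open import Data.Fin.Subset using (Subset; _∈_; _⊆_; ∣_∣)
open import Data.Product using (Σ; _×_; ∃-syntax)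
open import Relation.Nullary using (¬_)
open import Relation.Binary.PropositionalEquality using (_≡_)
open import Level using (0ℓ)

record Graph (n : ℕ) : Set₁ where
  field
    Adj     : Fin n → Fin n → Set
    sym     : ∀ {u v} → Adj u v → Adj v u
    irrefl  : ∀ {u} → ¬ Adj u u
open Graph public

-- WalkIn G S ℓ u v : a walk of length exactly ℓ from u to v in G
-- all of whose vertices lie in S (i.e. a walk in the induced subgraph G[S]).
data WalkIn {n : ℕ} (G : Graph n) (S : Subset n) : ℕ → Fin n → Fin n → Set where
  here : ∀ {u} → u ∈ S → WalkIn G S zero u u
  step : ∀ {ℓ u v w} → u ∈ S → Adj G u v → WalkIn G S ℓ v w → WalkIn G S (suc ℓ) u w

DistInLe : ∀ {n} → Graph n → Subset n → ℕ → Fin n → Fin n → Set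
DistInLe G S i u v = ∃[ ℓ ] (ℓ ≤ i × WalkIn G S ℓ u v)

full : ∀ {n} → Subset n
full = Data.Fin.Subset.⊤

DistLe : ∀ {n} → Graph n → ℕ → Fin n → Fin n → Set
DistLe G = DistInLe G full

DiamAtMost : ∀ {n} → Graph n → Subset n → ℕ → Set
DiamAtMost G S s = ∀ {u v} → u ∈ S → v ∈ S → DistInLe G S s u v

IsClique : ∀ {n} → Graph n → Subset n → Set
IsClique G W = ∀ {u v} → u ∈ W → v ∈ W → ¬ u ≡ v → Adj G u v

IsClosedNbhd : ∀ {n} → Graph n → Subset n → ℕ → Subset n → Set
IsClosedNbhd G W i N = ∀ u → (u ∈ N → ∃[ w ] (w ∈ W × DistLe G i u w))
                           × (∃[ w ] (w ∈ W × DistLe G i u w) → u ∈ N)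

SeededSClubYes : ∀ {n} → ℕ → Graph n → Subset n → ℕ → Set
SeededSClubYes s G W k = ∃[ S ] (W ⊆ S × k ≤ ∣ S ∣ × DiamAtMost G S s)

-- Let s = 1 + a + r with a = ⌊(s-1)/2⌋ and r = ⌈(s-1)/2⌉.  Every u ∈ N_{s-1}[W] has a walk of
-- length at most s-1 to W; cut it after r steps at a "centre" c(u).  If at least k distinct
-- centres occur, the tails of the walks together with W form a set in which every vertex is
-- within a of the clique W, hence of diameter at most a + 1 + a ≤ s.  Otherwise, as |N| ≥ k²,
-- some centre y is shared by at least k vertices; their whole walks together with W form a set
-- in which every vertex outside W is within r of y, and y is within a of W, so every distance
-- is at most max(2r, 1 + a + r) ≤ s.

module Submission where

open import Defs hiding (sym)
open import Data.Bool using (if_then_else_)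
open import Data.Nat using (ℕ; zero; suc; _+_; _*_; _∸_; _⊓_; _≤_; _<_; z≤n; s≤s; _≤?_; ⌊_/2⌋; ⌈_/2⌉)
open import Data.Nat.Properties hiding (_≟_)
open import Algebra.Properties.Semiring.Sum +-*-semiring
  using (sum; ∑-comm; sum-cong-≗; sum-replicate-zero; *-distribˡ-sum)
open import Data.Fin using (Fin; zero; suc; _≟_)
open import Data.Fin.Properties using (any?)
open import Data.Fin.Subset using (Subset; _∈_; _⊆_; ⊥; ⁅_⁆; _∪_; ∣_∣; Nonempty; inside; outside)
open import Data.Fin.Subset.Properties
  using (_∈?_; nonempty?; Empty-unique; ∣⊥∣≡0; ∉⊥; x∈⁅x⁆; x∈⁅y⁆⇒x≡y; x∈p∪q⁺; x∈p∪q⁻; p⊆p∪q; q⊆p∪q; p⊆q⇒∣p∣≤∣q∣)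
open import Data.Vec using ([]; _∷_; here; there)
open import Data.Vec.Functional using (Vector)
open import Data.Product using (_×_; _,_; ∃; ∃-syntax; proj₁)
open import Data.Sum using (_⊎_; inj₁; inj₂; [_,_]′)
open import Function using (_∘_)
open import Relation.Nullary using (Dec; does; yes; no; ¬_; contradiction)
open import Relation.Nullary.Decidable using (_×-dec_)
open import Relation.Unary using (Pred; Decidable)
open import Relation.Binary.PropositionalEquality using (_≡_; refl; sym; trans; cong; module ≡-Reasoning)

private variable
  n m : ℕ

-- Walks and distances in induced subgraphs

module _ (G : Graph n) where

  private variable
    S T : Subset n
    i j k ℓ : ℕ
    u v w x : Fin n

  walk-mono-⊆ : S ⊆ T → WalkIn G S ℓ u v → WalkIn G T ℓ u v
  walk-mono-⊆ S⊆T (here u∈S)     = here (S⊆T u∈S)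
  walk-mono-⊆ S⊆T (step u∈S e p) = step (S⊆T u∈S) e (walk-mono-⊆ S⊆T p)

  walk-++ : WalkIn G S ℓ u v → WalkIn G S k v w → WalkIn G S (ℓ + k) u w
  walk-++ (here _)       q = q
  walk-++ (step u∈S e p) q = step u∈S e (walk-++ p q)

  walk-snoc : WalkIn G S ℓ u v → Adj G v w → w ∈ S → WalkIn G S (suc ℓ) u w
  walk-snoc (here v∈S)     e w∈S = step v∈S e (here w∈S)
  walk-snoc (step u∈S e p) f w∈S = step u∈S e (walk-snoc p f w∈S)

  walk-reverse : WalkIn G S ℓ u v → WalkIn G S ℓ v u
  walk-reverse (here u∈S)     = here u∈S
  walk-reverse (step u∈S e p) = walk-snoc (walk-reverse p) (Graph.sym G e) u∈S

  walk-splitAt : ∀ r → WalkIn G S ℓ u w →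
                 ∃[ c ] (WalkIn G S (ℓ ⊓ r) u c × WalkIn G S (ℓ ∸ r) c w)
  walk-splitAt zero    (here u∈S)       = _ , here u∈S , here u∈S
  walk-splitAt zero    p@(step u∈S _ _) = _ , here u∈S , p
  walk-splitAt (suc r) (here u∈S)       = _ , here u∈S , here u∈S
  walk-splitAt (suc r) (step u∈S e p) with walk-splitAt r p
  ... | c , p₁ , p₂ = c , step u∈S e p₁ , p₂

  dist-step : u ∈ S → Adj G u v → DistInLe G S i v w → DistInLe G S (suc i) u w
  dist-step u∈S e (ℓ , ℓ≤i , p) = suc ℓ , s≤s ℓ≤i , step u∈S e p

  dist-trans : DistInLe G S i u v → DistInLe G S j v w → DistInLe G S (i + j) u w
  dist-trans (ℓ , ℓ≤i , p) (m , m≤j , q) = ℓ + m , +-mono-≤ ℓ≤i m≤j , walk-++ p q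

  dist-sym : DistInLe G S i u v → DistInLe G S i v u
  dist-sym (ℓ , ℓ≤i , p) = ℓ , ℓ≤i , walk-reverse p

  dist-mono-≤ : i ≤ j → DistInLe G S i u v → DistInLe G S j u v
  dist-mono-≤ i≤j (ℓ , ℓ≤i , p) = ℓ , ≤-trans ℓ≤i i≤j , p

  dist-mono-⊆ : S ⊆ T → DistInLe G S i u v → DistInLe G T i u v
  dist-mono-⊆ S⊆T (ℓ , ℓ≤i , p) = ℓ , ℓ≤i , walk-mono-⊆ S⊆T p

  clique-dist : ∀ {W} → IsClique G W → W ⊆ S → u ∈ W → v ∈ W → DistInLe G S 1 u v
  clique-dist {u = u} {v} W-clique W⊆S u∈W v∈W with u ≟ v
  ... | yes refl = 0 , z≤n , here (W⊆S u∈W)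
  ... | no u≢v   = 1 , ≤-refl , step (W⊆S u∈W) (W-clique u∈W v∈W u≢v) (here (W⊆S v∈W))

  vertices : WalkIn G S ℓ u v → Subset n
  vertices (here {u} _)        = ⁅ u ⁆
  vertices (step {u = u} _ _ p) = ⁅ u ⁆ ∪ vertices p

  start∈vertices : (p : WalkIn G S ℓ u v) → u ∈ vertices p
  start∈vertices (here {u} _)         = x∈⁅x⁆ u
  start∈vertices (step {u = u} _ _ _) = x∈p∪q⁺ (inj₁ (x∈⁅x⁆ u))

  walk-in-vertices : (p : WalkIn G S ℓ u v) → WalkIn G (vertices p) ℓ u v
  walk-in-vertices p@(here _)     = here (start∈vertices p)
  walk-in-vertices p@(step _ e q) =
    step (start∈vertices p) e (walk-mono-⊆ (q⊆p∪q _ _) (walk-in-vertices q))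

  vertex-to-end : (p : WalkIn G S ℓ u v) → x ∈ vertices p → DistInLe G (vertices p) ℓ x v
  vertex-to-end (here {u} _) x∈p with x∈⁅y⁆⇒x≡y u x∈p
  ... | refl = 0 , z≤n , here x∈p
  vertex-to-end p@(step {u = u} _ _ q) x∈p with x∈p∪q⁻ ⁅ u ⁆ _ x∈p
  ... | inj₁ x∈⁅u⁆ with x∈⁅y⁆⇒x≡y u x∈⁅u⁆
  ...   | refl = _ , ≤-refl , walk-in-vertices p
  vertex-to-end p@(step _ _ q) x∈p | inj₂ x∈q =
    dist-mono-≤ (n≤1+n _) (dist-mono-⊆ (q⊆p∪q _ _) (vertex-to-end q x∈q))

  start-to-vertex : (p : WalkIn G S ℓ u v) → x ∈ vertices p → DistInLe G (vertices p) ℓ u x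
  start-to-vertex (here {u} _) x∈p with x∈⁅y⁆⇒x≡y u x∈p
  ... | refl = 0 , z≤n , here x∈p
  start-to-vertex p@(step {u = u} _ e q) x∈p with x∈p∪q⁻ ⁅ u ⁆ _ x∈p
  ... | inj₁ x∈⁅u⁆ with x∈⁅y⁆⇒x≡y u x∈⁅u⁆
  ...   | refl = 0 , z≤n , here x∈p
  start-to-vertex p@(step _ e q) x∈p | inj₂ x∈q =
    dist-step (start∈vertices p) e (dist-mono-⊆ (q⊆p∪q _ _) (start-to-vertex q x∈q))


module _ (G : Graph n) {S : Subset n} {W : Subset n} (W-clique : IsClique G W) (W⊆S : W ⊆ S) where

  diam-around-clique : ∀ {a s} → (∀ {x} → x ∈ S → ∃[ w ] (w ∈ W × DistInLe G S a x w)) →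
                       a + suc a ≤ s → DiamAtMost G S s
  diam-around-clique near-W a+1+a≤s x∈S x′∈S with near-W x∈S | near-W x′∈S
  ... | w , w∈W , x~w | w′ , w′∈W , x′~w′ =
    dist-mono-≤ G a+1+a≤s
      (dist-trans G x~w (dist-trans G (clique-dist G W-clique W⊆S w∈W w′∈W) (dist-sym G x′~w′)))

  dist-via-hub : ∀ {a r u v y w} → w ∈ W → DistInLe G S a y w → u ∈ W → DistInLe G S r v y →
                 DistInLe G S (suc (a + r)) u v
  dist-via-hub w∈W y~w u∈W v~y =
    dist-trans G (clique-dist G W-clique W⊆S u∈W w∈W) (dist-trans G (dist-sym G y~w) (dist-sym G v~y))

  diam-around-hub : ∀ {a r s y} → ∃[ w ] (w ∈ W × DistInLe G S a y w) →
                    (∀ {x} → x ∈ S → x ∈ W ⊎ DistInLe G S r x y) →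
                    r + r ≤ s → suc (a + r) ≤ s → DiamAtMost G S s
  diam-around-hub (w , w∈W , y~w) near-hub r+r≤s 1+a+r≤s x∈S x′∈S with near-hub x∈S | near-hub x′∈S
  ... | inj₁ x∈W | inj₁ x′∈W =
    dist-mono-≤ G (≤-trans (s≤s z≤n) 1+a+r≤s) (clique-dist G W-clique W⊆S x∈W x′∈W)
  ... | inj₁ x∈W | inj₂ x′~y = dist-mono-≤ G 1+a+r≤s (dist-via-hub w∈W y~w x∈W x′~y)
  ... | inj₂ x~y | inj₁ x′∈W = dist-mono-≤ G 1+a+r≤s (dist-sym G (dist-via-hub w∈W y~w x′∈W x~y))
  ... | inj₂ x~y | inj₂ x′~y = dist-mono-≤ G r+r≤s (dist-trans G x~y (dist-sym G x′~y))

-- Fibres and images of a map on a finite set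

-- Defined through `does` so that it computes on decisions built with map′.
[_] : ∀ {a} {A : Set a} → Dec A → ℕ
[ d ] = if does d then 1 else 0

∑-mono-≤ : {f g : Vector ℕ n} → (∀ i → f i ≤ g i) → sum f ≤ sum g
∑-mono-≤ {zero}  f≤g = z≤n
∑-mono-≤ {suc n} f≤g = +-mono-≤ (f≤g zero) (∑-mono-≤ (f≤g ∘ suc))

∑[c≟i]≡1 : (c : Fin n) → sum (λ i → [ c ≟ i ]) ≡ 1
∑[c≟i]≡1 {suc n} zero    = cong suc (sum-replicate-zero n)
∑[c≟i]≡1 {suc n} (suc c) = ∑[c≟i]≡1 c

∣p∣≡∑[i∈p] : (p : Subset n) → ∣ p ∣ ≡ sum (λ i → [ i ∈? p ])
∣p∣≡∑[i∈p] []            = refl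
∣p∣≡∑[i∈p] (inside  ∷ p) = cong suc (∣p∣≡∑[i∈p] p)
∣p∣≡∑[i∈p] (outside ∷ p) = ∣p∣≡∑[i∈p] p

∣p∣>0⇒Nonempty : (p : Subset n) → 0 < ∣ p ∣ → Nonempty p
∣p∣>0⇒Nonempty {n} p 0<∣p∣ with nonempty? p
... | yes ne = ne
... | no  ¬ne = contradiction (trans (cong ∣_∣ (Empty-unique ¬ne)) (∣⊥∣≡0 n)) (>⇒≢ 0<∣p∣)

⟦_⟧ : ∀ {ℓ} {P : Pred (Fin n) ℓ} → Decidable P → Subset n
⟦_⟧ {zero}  P? = []
⟦_⟧ {suc n} P? = does (P? zero) ∷ ⟦ P? ∘ suc ⟧

∈⟦⟧⁺ : ∀ {ℓ} {P : Pred (Fin n) ℓ} (P? : Decidable P) {x} → P x → x ∈ ⟦ P? ⟧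
∈⟦⟧⁺ P? {zero} px with P? zero
... | yes _   = here
... | no ¬px = contradiction px ¬px
∈⟦⟧⁺ P? {suc x} px = there (∈⟦⟧⁺ (P? ∘ suc) px)

∈⟦⟧⁻ : ∀ {ℓ} {P : Pred (Fin n) ℓ} (P? : Decidable P) {x} → x ∈ ⟦ P? ⟧ → P x
∈⟦⟧⁻ P? {zero} x∈ with P? zero
... | yes px = px
∈⟦⟧⁻ P? {zero} () | no _
∈⟦⟧⁻ P? {suc x} (there x∈) = ∈⟦⟧⁻ (P? ∘ suc) x∈

∣⟦⟧∣≡∑ : ∀ {ℓ} {P : Pred (Fin n) ℓ} (P? : Decidable P) → ∣ ⟦ P? ⟧ ∣ ≡ sum (λ x → [ P? x ])
∣⟦⟧∣≡∑ {zero}  P? = refl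
∣⟦⟧∣≡∑ {suc n} P? with P? zero
... | yes _ = cong suc (∣⟦⟧∣≡∑ (P? ∘ suc))
... | no  _ = ∣⟦⟧∣≡∑ (P? ∘ suc)

⋃[_]_ : Subset m → (Fin m → Subset n) → Subset n
⋃[ p ] F = ⟦ (λ x → any? (λ i → i ∈? p ×-dec x ∈? F i)) ⟧

module _ {p : Subset m} {F : Fin m → Subset n} where

  F⊆⋃ : ∀ {i} → i ∈ p → F i ⊆ ⋃[ p ] F
  F⊆⋃ i∈p x∈Fi = ∈⟦⟧⁺ _ (_ , i∈p , x∈Fi)

  x∈⋃⁻ : ∀ {x} → x ∈ ⋃[ p ] F → ∃ λ i → i ∈ p × x ∈ F i
  x∈⋃⁻ = ∈⟦⟧⁻ _

module _ (f : Fin n → Fin m) (p : Subset n) where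

  inFibre? : ∀ y → Decidable (λ x → x ∈ p × f x ≡ y)
  inFibre? y x = x ∈? p ×-dec f x ≟ y

  inImage? : Decidable (λ y → ∃ λ x → x ∈ p × f x ≡ y)
  inImage? y = any? (inFibre? y)

  fibre : Fin m → Subset n
  fibre y = ⟦ inFibre? y ⟧

  image : Subset m
  image = ⟦ inImage? ⟧

  ∈fibre⁻ : ∀ {y x} → x ∈ fibre y → x ∈ p × f x ≡ y
  ∈fibre⁻ {y} = ∈⟦⟧⁻ (inFibre? y)

  ∈image⁻ : ∀ {y} → y ∈ image → ∃ λ x → x ∈ p × f x ≡ y
  ∈image⁻ = ∈⟦⟧⁻ inImage?

  ∣p∣≡∑∣fibre∣ : ∣ p ∣ ≡ sum (λ y → ∣ fibre y ∣)
  ∣p∣≡∑∣fibre∣ = begin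
    ∣ p ∣                                    ≡⟨ ∣p∣≡∑[i∈p] p ⟩
    sum (λ x → [ x ∈? p ])                   ≡⟨ sum-cong-≗ [x∈p]≡∑[x∈fibre] ⟩
    sum (λ x → sum (λ y → [ inFibre? y x ])) ≡⟨ ∑-comm (λ x y → [ inFibre? y x ]) ⟩
    sum (λ y → sum (λ x → [ inFibre? y x ])) ≡⟨ sum-cong-≗ (λ y → sym (∣⟦⟧∣≡∑ (inFibre? y))) ⟩
    sum (λ y → ∣ fibre y ∣)                  ∎
    where
    open ≡-Reasoning
    [x∈p]≡∑[x∈fibre] : ∀ x → [ x ∈? p ] ≡ sum (λ y → [ inFibre? y x ])
    [x∈p]≡∑[x∈fibre] x with x ∈? p
    ... | yes _ = sym (∑[c≟i]≡1 (f x))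
    ... | no  _ = sym (sum-replicate-zero m)

  ∣fibre∣≤b*[∈image] : ∀ {b} → (∀ y → ∣ fibre y ∣ ≤ b) → ∀ y → ∣ fibre y ∣ ≤ b * [ inImage? y ]
  ∣fibre∣≤b*[∈image] {b} ∣fibre∣≤b y with inImage? y
  ... | yes _ = ≤-trans (∣fibre∣≤b y) (≤-reflexive (sym (*-identityʳ b)))
  ... | no ¬∃ = ≤-reflexive (trans ∣fibre∣≡0 (sym (*-zeroʳ b)))
    where
    ∣fibre∣≡0 : ∣ fibre y ∣ ≡ 0
    ∣fibre∣≡0 = trans (cong ∣_∣ (Empty-unique λ (x , x∈) → ¬∃ (x , ∈⟦⟧⁻ (inFibre? y) x∈))) (∣⊥∣≡0 n)

  ∣p∣≤b*∣image∣ : ∀ b → (∀ y → ∣ fibre y ∣ ≤ b) → ∣ p ∣ ≤ b * ∣ image ∣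
  ∣p∣≤b*∣image∣ b ∣fibre∣≤b = begin
    ∣ p ∣                             ≡⟨ ∣p∣≡∑∣fibre∣ ⟩
    sum (λ y → ∣ fibre y ∣)           ≤⟨ ∑-mono-≤ (∣fibre∣≤b*[∈image] ∣fibre∣≤b) ⟩
    sum (λ y → b * [ inImage? y ])    ≡⟨ sym (*-distribˡ-sum b (λ y → [ inImage? y ])) ⟩
    b * sum (λ y → [ inImage? y ])    ≡⟨ cong (b *_) (sym (∣⟦⟧∣≡∑ inImage?)) ⟩
    b * ∣ image ∣                     ∎
    where open ≤-Reasoning

  square-pigeonhole : ∀ k → k * k ≤ ∣ p ∣ → k ≤ ∣ image ∣ ⊎ ∃ λ y → k ≤ ∣ fibre y ∣
  square-pigeonhole zero    _      = inj₁ z≤n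
  square-pigeonhole (suc k) k²≤∣p∣ with any? (λ y → suc k ≤? ∣ fibre y ∣)
  ... | yes big-fibre = inj₂ big-fibre
  ... | no ¬big-fibre = inj₁ (≰⇒> small-image-impossible)
    where
    small-fibres : ∀ y → ∣ fibre y ∣ ≤ k
    small-fibres y = ≤-pred (≰⇒> λ big → ¬big-fibre (y , big))
    small-image-impossible : ¬ (∣ image ∣ ≤ k)
    small-image-impossible ∣image∣≤k = <⇒≱ (*-mono-< (n<1+n k) (n<1+n k)) (begin
      suc k * suc k  ≤⟨ k²≤∣p∣ ⟩
      ∣ p ∣          ≤⟨ ∣p∣≤b*∣image∣ k small-fibres ⟩
      k * ∣ image ∣  ≤⟨ *-monoʳ-≤ k ∣image∣≤k ⟩
      k * k          ∎)
      where open ≤-Reasoning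

⌈n/2⌉≤1+⌊n/2⌋ : ∀ n → ⌈ n /2⌉ ≤ suc ⌊ n /2⌋
⌈n/2⌉≤1+⌊n/2⌋ zero          = z≤n
⌈n/2⌉≤1+⌊n/2⌋ (suc zero)    = s≤s z≤n
⌈n/2⌉≤1+⌊n/2⌋ (suc (suc n)) = s≤s (⌈n/2⌉≤1+⌊n/2⌋ n)

-- The two candidate clubs

seededClub-≤ : ∀ {s} {G : Graph n} {W k k′} → k ≤ k′ → SeededSClubYes s G W k′ → SeededSClubYes s G W k
seededClub-≤ k≤k′ (S , W⊆S , k′≤∣S∣ , diam) = S , W⊆S , ≤-trans k≤k′ k′≤∣S∣ , diam

module Centres {G : Graph n} {W : Subset n} (W-clique : IsClique G W) (t : ℕ) {N : Subset n}
                    (N-near-W : ∀ {u} → u ∈ N → ∃[ w ] (w ∈ W × DistLe G t u w)) where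

  r a : ℕ
  r = ⌈ t /2⌉
  a = ⌊ t /2⌋

  a+r≡t : a + r ≡ t
  a+r≡t = ⌊n/2⌋+⌈n/2⌉≡n t

  record Route (u : Fin n) : Set where
    field
      pivot     : Fin n
      {w}       : Fin n
      {ℓ₁ ℓ₂}   : ℕ
      w∈W       : w ∈ W
      head      : WalkIn G full ℓ₁ u pivot
      tail      : WalkIn G full ℓ₂ pivot w
      ℓ₁≤r      : ℓ₁ ≤ r
      ℓ₂≤a      : ℓ₂ ≤ a
  open Route

  route : ∀ {u} → u ∈ N → Route u
  route u∈N with N-near-W u∈N
  ... | w , w∈W , ℓ , ℓ≤t , p with walk-splitAt G r p
  ...   | c , p₁ , p₂ = record
    { pivot = c ; w∈W = w∈W ; head = p₁ ; tail = p₂ ; ℓ₁≤r = m⊓n≤n ℓ r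
    ; ℓ₂≤a = ≤-trans (∸-monoˡ-≤ r ℓ≤t) (≤-reflexive t∸r≡a) }
    where
    t∸r≡a : t ∸ r ≡ a
    t∸r≡a = trans (cong (_∸ r) (sym a+r≡t)) (m+n∸n≡m a r)

  -- Vertices outside N get the junk centre u and empty head and tail sets.
  centre : Fin n → Fin n
  centre u with u ∈? N
  ... | yes u∈N = pivot (route u∈N)
  ... | no  _   = u

  headSet tailSet : Fin n → Subset n
  headSet u with u ∈? N
  ... | yes u∈N = vertices G (head (route u∈N))
  ... | no  _   = ⊥
  tailSet u with u ∈? N
  ... | yes u∈N = vertices G (tail (route u∈N))
  ... | no  _   = ⊥

  u∈headSet : ∀ {u} → u ∈ N → u ∈ headSet u
  u∈headSet {u} u∈N with u ∈? N
  ... | yes u∈N′ = start∈vertices G (head (route u∈N′))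
  ... | no  u∉N  = contradiction u∈N u∉N

  centre∈tailSet : ∀ {u} → u ∈ N → centre u ∈ tailSet u
  centre∈tailSet {u} u∈N with u ∈? N
  ... | yes u∈N′ = start∈vertices G (tail (route u∈N′))
  ... | no  u∉N  = contradiction u∈N u∉N

  headSet-to-centre : ∀ u {x} → x ∈ headSet u → DistInLe G (headSet u) r x (centre u)
  headSet-to-centre u x∈ with u ∈? N
  ... | yes u∈N = dist-mono-≤ G (ℓ₁≤r (route u∈N)) (vertex-to-end G (head (route u∈N)) x∈)
  ... | no  _   = contradiction x∈ ∉⊥

  centre-to-tailSet : ∀ u {x} → x ∈ tailSet u → DistInLe G (tailSet u) a (centre u) x
  centre-to-tailSet u x∈ with u ∈? N
  ... | yes u∈N = dist-mono-≤ G (ℓ₂≤a (route u∈N)) (start-to-vertex G (tail (route u∈N)) x∈)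
  ... | no  _   = contradiction x∈ ∉⊥

  tailSet-near-W : ∀ u {x} → x ∈ tailSet u → ∃[ w ] (w ∈ W × DistInLe G (tailSet u) a x w)
  tailSet-near-W u x∈ with u ∈? N
  ... | yes u∈N = let ρ = route u∈N in w ρ , w∈W ρ , dist-mono-≤ G (ℓ₂≤a ρ) (vertex-to-end G (tail ρ) x∈)
  ... | no  _   = contradiction x∈ ∉⊥

  image-club : SeededSClubYes (suc t) G W ∣ image centre N ∣
  image-club = S , W⊆S , p⊆q⇒∣p∣≤∣q∣ image⊆S , diam-around-clique G W-clique W⊆S near-W a+1+a≤1+t
    where
    S : Subset n
    S = W ∪ ⋃[ N ] tailSet
    W⊆S : W ⊆ S
    W⊆S = p⊆p∪q _
    tailSet⊆S : ∀ {u} → u ∈ N → tailSet u ⊆ S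
    tailSet⊆S u∈N = q⊆p∪q W _ ∘ F⊆⋃ u∈N
    image⊆S : image centre N ⊆ S
    image⊆S y∈image with ∈image⁻ centre N y∈image
    ... | u , u∈N , refl = tailSet⊆S u∈N (centre∈tailSet u∈N)
    near-W : ∀ {x} → x ∈ S → ∃[ w ] (w ∈ W × DistInLe G S a x w)
    near-W {x} x∈S with x∈p∪q⁻ W _ x∈S
    ... | inj₁ x∈W = x , x∈W , 0 , z≤n , here x∈S
    ... | inj₂ x∈⋃ with x∈⋃⁻ x∈⋃
    ...   | u , u∈N , x∈tail with tailSet-near-W u x∈tail
    ...     | w , w∈W , x~w = w , w∈W , dist-mono-⊆ G (tailSet⊆S u∈N) x~w
    a+1+a≤1+t : a + suc a ≤ suc t
    a+1+a≤1+t = begin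
      a + suc a   ≡⟨ +-suc a a ⟩
      suc (a + a) ≤⟨ s≤s (+-monoʳ-≤ a (⌊n/2⌋≤⌈n/2⌉ t)) ⟩
      suc (a + r) ≡⟨ cong suc a+r≡t ⟩
      suc t       ∎
      where open ≤-Reasoning

  fibre-club : ∀ y → Nonempty (fibre centre N y) → SeededSClubYes (suc t) G W ∣ fibre centre N y ∣
  fibre-club y (u₀ , u₀∈F) =
    S , W⊆S , p⊆q⇒∣p∣≤∣q∣ F⊆S , diam-around-hub G W-clique W⊆S y-near-W near-y r+r≤1+t 1+a+r≤1+t
    where
    spoke : Fin n → Subset n
    spoke u = headSet u ∪ tailSet u
    F S : Subset n
    F = fibre centre N y
    S = W ∪ ⋃[ F ] spoke
    W⊆S : W ⊆ S
    W⊆S = p⊆p∪q _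
    spoke⊆S : ∀ {u} → u ∈ F → spoke u ⊆ S
    spoke⊆S u∈F = q⊆p∪q W _ ∘ F⊆⋃ u∈F
    F⊆S : F ⊆ S
    F⊆S u∈F = spoke⊆S u∈F (x∈p∪q⁺ (inj₁ (u∈headSet (proj₁ (∈fibre⁻ centre N u∈F)))))
    y-near-W : ∃[ w ] (w ∈ W × DistInLe G S a y w)
    y-near-W with ∈fibre⁻ centre N u₀∈F
    ... | u₀∈N , refl with tailSet-near-W u₀ (centre∈tailSet u₀∈N)
    ...   | w , w∈W , y~w = w , w∈W , dist-mono-⊆ G (spoke⊆S u₀∈F ∘ x∈p∪q⁺ ∘ inj₂) y~w
    near-y : ∀ {x} → x ∈ S → x ∈ W ⊎ DistInLe G S r x y
    near-y x∈S with x∈p∪q⁻ W _ x∈S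
    ... | inj₁ x∈W = inj₁ x∈W
    ... | inj₂ x∈⋃ with x∈⋃⁻ x∈⋃
    ...   | u , u∈F , x∈spoke with ∈fibre⁻ centre N u∈F | x∈p∪q⁻ (headSet u) _ x∈spoke
    ...     | _ , refl | inj₁ x∈head =
      inj₂ (dist-mono-⊆ G (spoke⊆S u∈F ∘ x∈p∪q⁺ ∘ inj₁) (headSet-to-centre u x∈head))
    ...     | _ , refl | inj₂ x∈tail =
      inj₂ (dist-mono-⊆ G (spoke⊆S u∈F ∘ x∈p∪q⁺ ∘ inj₂)
             (dist-sym G (dist-mono-≤ G (⌊n/2⌋≤⌈n/2⌉ t) (centre-to-tailSet u x∈tail))))
    r+r≤1+t : r + r ≤ suc t
    r+r≤1+t = ≤-trans (+-monoˡ-≤ r (⌈n/2⌉≤1+⌊n/2⌋ t)) (s≤s (≤-reflexive a+r≡t))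
    1+a+r≤1+t : suc (a + r) ≤ suc t
    1+a+r≤1+t = s≤s (≤-reflexive a+r≡t)

lemma9 : ∀ {n} (s : ℕ) (G : Graph n) (W : Subset n) (k : ℕ) →
         2 ≤ s → 1 ≤ k → IsClique G W → ∣ W ∣ < k →
         (N : Subset n) → IsClosedNbhd G W (s ∸ 1) N → k * k ≤ ∣ N ∣ →
         SeededSClubYes s G W k
lemma9 zero _ _ _ ()
lemma9 (suc t) G W k _ 1≤k W-clique _ N N-nbhd k²≤∣N∣ =
  [ (λ k≤∣image∣ → seededClub-≤ k≤∣image∣ image-club)
  , (λ (y , k≤∣fibre∣) → seededClub-≤ k≤∣fibre∣ (fibre-club y (∣p∣>0⇒Nonempty _ (≤-trans 1≤k k≤∣fibre∣))))
  ]′ (square-pigeonhole centre N k k²≤∣N∣)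
  where open Centres W-clique t (λ {u} → proj₁ (N-nbhd u))
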